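{- For any SDFS $F\subseteq\mathcal Q(\mathcal T)$: (i) $F$ is finitely consistent if and only if $E(\mathcal V)=\{D\in\overline{\mathbf D}:\mathcal V\subseteq F_D\}\neq\emptyset$ for all finite $\mathcal V\subseteq F$; (ii) $\mathrm{cl}_{\mathbf F}(F)=\bigcup_{\mathcal V\subseteq F,\ \mathcal V\text{ finite}}\ \bigcap_{D\in\overline{\mathbf D}:\ \mathcal V\subseteq F_D}F_D$; (iii) $F$ is finitely coherent if and only if $F$ is finitely consistent and $F=\bigcup_{\mathcal V\subseteq F,\ \mathcal V\text{ finite}}\ \bigcap_{D\in\overline{\mathbf D}:\ \mathcal V\subseteq F_D}F_D$.
   Context: Let $\mathcal T$ be a non-empty set (of "things"), $\mathrm{cl}:\mathcal P(\mathcal T)\to\mathcal P(\mathcal T)$ a closure operator (extensive, monotone, idempotent), $\mathcal T_-\subseteq\mathcal T$ a set of forbidden things, $\mathcal T_+:=\mathrm{cl}(\emptyset)$, with standing assumption $\mathcal T_+\cap\mathcal T_-=\emptyset$. A coherent SDT is a $D\subseteq\mathcal T$ with $\mathrm{cl}(D)=D$ and $D\cap\mathcal T_-=\emptyset$; $\overline{\mathbf D}$ is the set of all coherent SDTs. $\mathcal Q(\mathcal T)$ is the set of finite subsets of $\mathcal T$ (including $\emptyset$). For $\mathcal V\subseteq\mathcal Q(\mathcal T)$, $\Sigma_{\mathcal V}$ is the set of maps $\sigma:\mathcal V\to\mathcal T$ with $\sigma(A)\in A$ for all $A\in\mathcal V$, and $\sigma(\mathcal V):=\{\sigma(A):A\in\mathcal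 V\}$. An SDFS is any $F\subseteq\mathcal Q(\mathcal T)$. It is finitely coherent if (F1) $\emptyset\notin F$; (F2) if $A_1\in F$ and $A_1\subseteq A_2\in\mathcal Q(\mathcal T)$ then $A_2\in F$; (F3) if $A\in F$ then $A\setminus\mathcal T_-\in F$; (F4) $\{t\}\in F$ for all $t\in\mathcal T_+$; (F5) for every non-empty finite $\mathcal V\subseteq F$ and every family $(t_\sigma)_{\sigma\in\Sigma_{\mathcal V}}$ with $t_\sigma\in\mathrm{cl}(\sigma(\mathcal V))$, $\{t_\sigma:\sigma\in\Sigma_{\mathcal V}\}\in F$. An SDFS is finitely consistent if it is included in some finitely coherent SDFS. $\mathrm{cl}_{\mathbf F}(F)$ denotes the intersection of all finitely coherent SDFSes including $F$, which is $\mathcal Q(\mathcal T)$ if there are none. For $D\subseteq\mathcal T$ let $F_D:=\{A\in\mathcal Q(\mathcal T):A\cap D\neq\emptyset\}$. For $S\subseteq\mathcal T$ let $\overline{\mathbf D}_S:=\{D\in\overline{\mathbf D}:S\cap D\neq\emptyset\}$ and $E(\mathcal V):=\bigcap_{A\in\mathcal V}\overline{\mathbf D}_A$ (with $E(\emptyset)=\overline{\mathbf D}$). An intersection over an empty family of $F_D$'s is taken to be $\mathcal Q(\mathcal T)$. -}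

module Defs where

open import Level using (Level; 0ℓ) renaming (suc to lsuc)
open import Data.Product using (Σ; ∃; _×_; _,_)
open import Data.Empty using (⊥)
open import Data.Sum using (_⊎_)
open import Data.List using (List; []; _∷_; [_])
open import Data.List.Membership.Propositional using (_∈_)
open import Relation.Nullary using (¬_)
open import Relation.Binary.PropositionalEquality using (_≡_)
open import Function.Bundles using (_⇔_)

Subset : Set → Set₁
Subset T = T → Set

_⊆ˢ_ : {T : Set} → Subset T → Subset T → Set
X ⊆ˢ Y = ∀ t → X t → Y t

∅ˢ : {T : Set} → Subset T
∅ˢ _ = ⊥

record IsClosureOperator {T : Set} (cl : Subset T → Subset T) : Set₁ where
  field
    extensive  : ∀ X → X ⊆ˢ cl X
    monotone   : ∀ X Y → X ⊆ˢ Y → cl X ⊆ˢ cl Y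
    idempotent : ∀ X → (cl (cl X) ⊆ˢ cl X) × (cl X ⊆ˢ cl (cl X))

module Setup (T : Set) (cl : Subset T → Subset T) (T₋ : Subset T) where

  T₊ : Subset T
  T₊ = cl ∅ˢ

  -- Finite subsets of T (elements of Q(T)) are represented by lists;
  -- the finite set represented by A is {t | t ∈ A}.
  Fin⟦_⟧ : List T → Subset T
  Fin⟦ A ⟧ t = t ∈ A

  Enumerates : List T → Subset T → Set
  Enumerates B X = ∀ x → (x ∈ B) ⇔ X x

  CoherentSDT : Subset T → Set
  CoherentSDT D = ((cl D ⊆ˢ D) × (D ⊆ˢ cl D)) × (∀ t → D t → ¬ T₋ t)

  SDFS : Set₁
  SDFS = List T → Set

  _⊆F_ : SDFS → SDFS → Set
  F ⊆F G = ∀ A → F A → G A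

  Meets : List T → Subset T → Set
  Meets A D = Σ T λ t → (t ∈ A) × D t

  F[_] : Subset T → SDFS
  F[ D ] A = Meets A D

  -- Selections σ ∈ Σ_V for a finite family V (a list of finite sets):
  -- one chosen element of each member of V.
  data Sel : List (List T) → Set where
    []  : Sel []
    _∷_ : ∀ {A V} → Σ T (λ t → t ∈ A) → Sel V → Sel (A ∷ V)

  image : ∀ {V} → Sel V → Subset T
  image []             t = ⊥
  image ((s , _) ∷ σ)  t = (t ≡ s) ⊎ image σ t

  F1 : SDFS → Set
  F1 F = ¬ F []

  F2 : SDFS → Set
  F2 F = ∀ A₁ A₂ → F A₁ → Fin⟦ A₁ ⟧ ⊆ˢ Fin⟦ A₂ ⟧ → F A₂

  F3 : SDFS → Set
  F3 F = ∀ A → F A → ∀ B → Enumerates B (λ x → (x ∈ A) × ¬ T₋ x) → F B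

  F4 : SDFS → Set
  F4 F = ∀ t → T₊ t → F [ t ]

  F5 : SDFS → Set
  F5 F = ∀ (A₀ : List T) (V′ : List (List T)) → let V = A₀ ∷ V′ in
         (∀ A → A ∈ V → F A) →
         (t : Sel V → T) → (∀ σ → cl (image σ) (t σ)) →
         ∀ B → Enumerates B (λ x → Σ (Sel V) λ σ → x ≡ t σ) → F B

  FinitelyCoherent : SDFS → Set
  FinitelyCoherent F = F1 F × F2 F × F3 F × F4 F × F5 F

  FinitelyConsistent : SDFS → Set₁
  FinitelyConsistent F = Σ SDFS λ G → FinitelyCoherent G × (F ⊆F G)

  clF : SDFS → List T → Set₁
  clF F A = ∀ (G : SDFS) → FinitelyCoherent G → F ⊆F G → G A

  D̄[_] : List T → Subset T → Set
  D̄[ S ] D = CoherentSDT D × Meets S D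

  E : List (List T) → Subset T → Set
  E V D = CoherentSDT D × (∀ A → A ∈ V → D̄[ A ] D)

  Rhs : SDFS → List T → Set₁
  Rhs F A = Σ (List (List T)) λ V → (∀ A′ → A′ ∈ V → F A′) ×
            (∀ (D : Subset T) → CoherentSDT D → (∀ A′ → A′ ∈ V → F[ D ] A′) → F[ D ] A)

{-# OPTIONS --safe #-}
module Submission where

-- Write R(F) for the right-hand side of (ii).  Every finitely coherent G ⊇ F
-- contains R(F): if V ⊆ F and every coherent SDT meeting all members of V
-- meets A, then for each selection σ the set cl(σ(V)) either contains a
-- forbidden thing or is such an SDT and so meets A; choosing t_σ there, F5, F3
-- and F2 put A into G.  Taking G = F, E(V) ≠ ∅ for V ⊆ G, as otherwise
-- ∅ ∈ R(G) ⊆ G.  Conversely, if every E(V) with V ⊆ F is non-empty then R(F)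
-- is itself finitely coherent (for F5: a coherent D meeting every member of V
-- contains some σ(V), hence cl(σ(V)) ∋ t_σ), while if some E(V) is empty then
-- R(F) contains every finite set.

open import Defs
open import Level using (0ℓ; lift; lower)
open import Data.Product using (Σ; _×_; _,_; proj₁; proj₂)
open import Data.Sum using (_⊎_; inj₁; inj₂; [_,_]′)
open import Data.Empty using (⊥-elim)
open import Data.List using (List; []; _∷_; [_]; map; _++_; filter; cartesianProductWith)
open import Data.List.Relation.Unary.Any using (here; there)
open import Data.List.Membership.Propositional using (_∈_)
open import Data.List.Membership.Propositional.Properties
  using (∈-map⁺; ∈-map⁻; ∈-++⁺ˡ; ∈-++⁺ʳ; ∈-++⁻; ∈-filter⁺; ∈-filter⁻; ∈-cartesianProductWith⁺)
open import Relation.Nullary using (¬_; Dec; yes; no)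
open import Relation.Nullary.Decidable using (map′; True; toWitness; fromWitness; decidable-stable)
open import Relation.Binary.PropositionalEquality using (_≡_; refl; sym; subst)
open import Function.Bundles using (_⇔_; mk⇔; Equivalence)
open import Axiom.ExcludedMiddle using (ExcludedMiddle)

filter-enumerates : ∀ {T : Set} {P : T → Set} (P? : ∀ x → Dec (P x)) (B : List T) →
                    ∀ x → (x ∈ filter P? B) ⇔ ((x ∈ B) × P x)
filter-enumerates P? B x = mk⇔ (∈-filter⁻ P?) (λ (x∈B , Px) → ∈-filter⁺ P? x∈B Px)

module Selections {T : Set} {cl : Subset T → Subset T} {T₋ : Subset T} where
  open Setup T cl T₋

  members : (A : List T) → List (Σ T (_∈ A))
  members []      = []
  members (a ∷ A) = (a , here refl) ∷ map (λ (t , t∈A) → t , there t∈A) (members A)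

  ∈-members : ∀ A (x : Σ T (_∈ A)) → x ∈ members A
  ∈-members (a ∷ A) (t , here refl) = here refl
  ∈-members (a ∷ A) (t , there t∈A) = there (∈-map⁺ _ (∈-members A (t , t∈A)))

  selections : (V : List (List T)) → List (Sel V)
  selections []      = [ [] ]
  selections (A ∷ V) = cartesianProductWith _∷_ (members A) (selections V)

  ∈-selections : ∀ V (σ : Sel V) → σ ∈ selections V
  ∈-selections []      []      = here refl
  ∈-selections (A ∷ V) (x ∷ σ) =
    ∈-cartesianProductWith⁺ _∷_ (∈-members A x) (∈-selections V σ)

  enumerates-image : ∀ V (t : Sel V → T) →
                     Enumerates (map t (selections V)) (λ x → Σ (Sel V) λ σ → x ≡ t σ)
  enumerates-image V t x = mk⇔
    (λ x∈B → let σ , _ , x≡tσ = ∈-map⁻ t x∈B in σ , x≡tσ)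
    (λ (σ , x≡tσ) → subst (_∈ map t (selections V)) (sym x≡tσ) (∈-map⁺ t (∈-selections V σ)))

  image-meets : ∀ {V A} (σ : Sel V) → A ∈ V → Meets A (image σ)
  image-meets ((s , s∈A) ∷ σ) (here refl) = s , s∈A , inj₁ refl
  image-meets (_ ∷ σ) (there A∈V) =
    let t , t∈A , t∈σ = image-meets σ A∈V in t , t∈A , inj₂ t∈σ

  selection-into : ∀ V D → (∀ A → A ∈ V → Meets A D) → Σ (Sel V) λ σ → image σ ⊆ˢ D
  selection-into []      D meets = [] , λ _ ()
  selection-into (A ∷ V) D meets
    with t , t∈A , t∈D ← meets A (here refl)
       | σ , σ⊆D ← selection-into V D (λ A′ A′∈V → meets A′ (there A′∈V)) =
    (t , t∈A) ∷ σ , λ { x (inj₁ refl) → t∈D ; x (inj₂ x∈σ) → σ⊆D x x∈σ }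

module Theory (T : Set) (cl : Subset T → Subset T) (isCl : IsClosureOperator cl)
              (T₋ : Subset T) (T₊∩T₋=∅ : ∀ t → Setup.T₊ T cl T₋ t → ¬ T₋ t) where
  open Setup T cl T₋
  open IsClosureOperator isCl
  open Selections {T} {cl} {T₋}

  cl-coherent : ∀ X → (∀ t → cl X t → ¬ T₋ t) → CoherentSDT (cl X)
  cl-coherent X allowed = (proj₁ (idempotent X) , extensive (cl X)) , allowed

  T₊-coherent : CoherentSDT T₊
  T₊-coherent = cl-coherent ∅ˢ T₊∩T₋=∅

  T₊⊆coherent : ∀ D → CoherentSDT D → T₊ ⊆ˢ D
  T₊⊆coherent D ((clD⊆D , _) , _) t t∈T₊ = clD⊆D t (monotone ∅ˢ D (λ _ ()) t t∈T₊)

  _⊆ᴸ_ : ∀ {ℓ} → List (List T) → (List T → Set ℓ) → Set ℓ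
  V ⊆ᴸ F = ∀ A → A ∈ V → F A

  -- Rhs F A unfolds to Σ V (V ⊆ᴸ F × V ⊨ A).
  _⊨_ : List (List T) → List T → Set₁
  V ⊨ A = ∀ (D : Subset T) → CoherentSDT D → V ⊆ᴸ F[ D ] → F[ D ] A

  Satisfiable : List (List T) → Set₁
  Satisfiable V = Σ (Subset T) (E V)

  FinitelySatisfiable : SDFS → Set₁
  FinitelySatisfiable F = ∀ V → V ⊆ᴸ F → Satisfiable V

  ⊆Rhs : ∀ F A → F A → Rhs F A
  ⊆Rhs F A A∈F = [ A ] , (λ { _ (here refl) → A∈F }) , λ D _ meets → meets A (here refl)

  unsatisfiable⇒Rhs : ∀ F A V → V ⊆ᴸ F → ¬ Satisfiable V → Rhs F A
  unsatisfiable⇒Rhs F A V V⊆F unsat =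
    V , V⊆F , λ D coh meets → ⊥-elim (unsat (D , coh , λ A′ A′∈V → coh , meets A′ A′∈V))

  module RhsClosure (F : SDFS) (sat : FinitelySatisfiable F) where

    Rhs-nonempty : ¬ Rhs F []
    Rhs-nonempty (V , V⊆F , V⊨[]) with D , coh , inE ← sat V V⊆F
      with () ← proj₁ (proj₂ (V⊨[] D coh (λ A A∈V → proj₂ (inE A A∈V))))

    Rhs-superset : ∀ A₁ A₂ → Rhs F A₁ → Fin⟦ A₁ ⟧ ⊆ˢ Fin⟦ A₂ ⟧ → Rhs F A₂
    Rhs-superset A₁ A₂ (V , V⊆F , V⊨A₁) A₁⊆A₂ = V , V⊆F , λ D coh meets →
      let t , t∈A₁ , t∈D = V⊨A₁ D coh meets in t , A₁⊆A₂ t t∈A₁ , t∈D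

    Rhs-unforbidden : ∀ A → Rhs F A → ∀ B → Enumerates B (λ x → (x ∈ A) × ¬ T₋ x) → Rhs F B
    Rhs-unforbidden A (V , V⊆F , V⊨A) B enum = V , V⊆F , λ D coh meets →
      let t , t∈A , t∈D = V⊨A D coh meets
      in t , Equivalence.from (enum t) (t∈A , proj₂ coh t t∈D) , t∈D

    Rhs-T₊ : ∀ t → T₊ t → Rhs F [ t ]
    Rhs-T₊ t t∈T₊ = [] , (λ _ ()) , λ D coh _ → t , here refl , T₊⊆coherent D coh t t∈T₊

    Rhs-joint : ∀ V → V ⊆ᴸ Rhs F →
                Σ (List (List T)) λ W → W ⊆ᴸ F × (∀ D → CoherentSDT D → W ⊆ᴸ F[ D ] → V ⊆ᴸ F[ D ])
    Rhs-joint []      _ = [] , (λ _ ()) , λ _ _ _ _ ()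
    Rhs-joint (A ∷ V) V⊆Rhs
      with W₁ , W₁⊆F , W₁⊨A ← V⊆Rhs A (here refl)
         | W₂ , W₂⊆F , W₂⊨V ← Rhs-joint V (λ A′ A′∈V → V⊆Rhs A′ (there A′∈V)) =
      W₁ ++ W₂ , (λ A′ A′∈W → [ W₁⊆F A′ , W₂⊆F A′ ]′ (∈-++⁻ W₁ A′∈W)) , λ D coh meets →
        λ { _ (here refl) → W₁⊨A D coh (λ A′ A′∈W₁ → meets A′ (∈-++⁺ˡ A′∈W₁))
          ; A′ (there A′∈V) → W₂⊨V D coh (λ A″ A″∈W₂ → meets A″ (∈-++⁺ʳ W₁ A″∈W₂)) A′ A′∈V }

    Rhs-selections : ∀ V → V ⊆ᴸ Rhs F → (t : Sel V → T) → (∀ σ → cl (image σ) (t σ)) →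
                     ∀ B → Enumerates B (λ x → Σ (Sel V) λ σ → x ≡ t σ) → Rhs F B
    Rhs-selections V V⊆Rhs t t∈cl B enum with W , W⊆F , W⊨V ← Rhs-joint V V⊆Rhs =
      W , W⊆F , λ D coh meets →
        let σ , σ⊆D = selection-into V D (W⊨V D coh meets)
            tσ∈D = proj₁ (proj₁ coh) (t σ) (monotone (image σ) D σ⊆D (t σ) (t∈cl σ))
        in t σ , Equivalence.from (enum (t σ)) (σ , refl) , tσ∈D

    coherent-if-⇔Rhs : (H : SDFS) → (∀ A → H A ⇔ Rhs F A) → FinitelyCoherent H
    coherent-if-⇔Rhs H H⇔Rhs =
        (λ []∈H → Rhs-nonempty (to []∈H))
      , (λ A₁ A₂ A₁∈H A₁⊆A₂ → from (Rhs-superset A₁ A₂ (to A₁∈H) A₁⊆A₂))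
      , (λ A A∈H B enum → from (Rhs-unforbidden A (to A∈H) B enum))
      , (λ t t∈T₊ → from (Rhs-T₊ t t∈T₊))
      , (λ A₀ V′ V⊆H t t∈cl B enum →
           from (Rhs-selections (A₀ ∷ V′) (λ A A∈V → to (V⊆H A A∈V)) t t∈cl B enum))
      where
      to : ∀ {A} → H A → Rhs F A
      to {A} = Equivalence.to (H⇔Rhs A)
      from : ∀ {A} → Rhs F A → H A
      from {A} = Equivalence.from (H⇔Rhs A)

  module Classical (em : ExcludedMiddle (Level.suc 0ℓ)) where

    decide : (P : Set) → Dec P
    decide P = map′ lower lift em

    cl-image-forbidden-or-meets : ∀ V A → V ⊨ A → (σ : Sel V) →
                                  Σ T λ t → cl (image σ) t × (T₋ t ⊎ t ∈ A)
    cl-image-forbidden-or-meets V A V⊨A σ with decide (Σ T λ t → cl (image σ) t × T₋ t)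
    ... | yes (t , t∈cl , forbidden) = t , t∈cl , inj₁ forbidden
    ... | no none
      with t , t∈A , t∈cl ← V⊨A (cl (image σ)) (cl-coherent _ λ t t∈cl t∈T₋ → none (t , t∈cl , t∈T₋))
                              (λ A′ A′∈V → let s , s∈A′ , s∈σ = image-meets σ A′∈V
                                           in s , s∈A′ , extensive _ s s∈σ)
      = t , t∈cl , inj₂ t∈A

    Rhs⊆coherent : ∀ F G → FinitelyCoherent G → F ⊆F G → ∀ A → Rhs F A → G A
    Rhs⊆coherent F G (_ , f2 , _ , f4 , _) F⊆G A ([] , _ , []⊨A)
      with t , t∈A , t∈T₊ ← []⊨A T₊ T₊-coherent (λ _ ())
      = f2 [ t ] A (f4 t t∈T₊) λ { _ (here refl) → t∈A }
    Rhs⊆coherent F G (_ , f2 , f3 , _ , f5) F⊆G A (A₀ ∷ V′ , V⊆F , V⊨A) =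
      f2 B′ A (f3 B B∈G B′ (filter-enumerates allowed? B)) B′⊆A
      where
      V = A₀ ∷ V′
      pick = cl-image-forbidden-or-meets V A V⊨A
      t : Sel V → T
      t σ = proj₁ (pick σ)
      B = map t (selections V)
      B∈G : G B
      B∈G = f5 A₀ V′ (λ A′ A′∈V → F⊆G A′ (V⊆F A′ A′∈V)) t (λ σ → proj₁ (proj₂ (pick σ)))
               B (enumerates-image V t)
      allowed? = λ x → decide (¬ T₋ x)
      B′ = filter allowed? B
      B′⊆A : Fin⟦ B′ ⟧ ⊆ˢ Fin⟦ A ⟧
      B′⊆A x x∈B′ with x∈B , allowed ← ∈-filter⁻ allowed? x∈B′
        with σ , refl ← Equivalence.to (enumerates-image V t x) x∈B
        with proj₂ (proj₂ (pick σ))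
      ... | inj₁ forbidden = ⊥-elim (allowed forbidden)
      ... | inj₂ tσ∈A      = tσ∈A

    coherent⇒satisfiable : ∀ G → FinitelyCoherent G → FinitelySatisfiable G
    coherent⇒satisfiable G coh V V⊆G with em {Satisfiable V}
    ... | yes sat   = sat
    ... | no  unsat = ⊥-elim (proj₁ coh (Rhs⊆coherent G G coh (λ _ A∈G → A∈G) []
                                           (unsatisfiable⇒Rhs G [] V V⊆G unsat)))

    consistent⇒satisfiable : ∀ F → FinitelyConsistent F → FinitelySatisfiable F
    consistent⇒satisfiable F (G , coh , F⊆G) V V⊆F =
      coherent⇒satisfiable G coh V (λ A A∈V → F⊆G A (V⊆F A A∈V))

    -- Rhs F lives in Set₁; excluded middle resizes it to an SDFS.
    Rhs↓ : SDFS → SDFS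
    Rhs↓ F A = True (em {Rhs F A})

    Rhs↓-coherent : ∀ F → FinitelySatisfiable F → FinitelyCoherent (Rhs↓ F)
    Rhs↓-coherent F sat = RhsClosure.coherent-if-⇔Rhs F sat (Rhs↓ F) λ A → mk⇔ toWitness fromWitness

    ⊆Rhs↓ : ∀ F → F ⊆F Rhs↓ F
    ⊆Rhs↓ F A A∈F = fromWitness (⊆Rhs F A A∈F)

    satisfiable⇒consistent : ∀ F → FinitelySatisfiable F → FinitelyConsistent F
    satisfiable⇒consistent F sat = Rhs↓ F , Rhs↓-coherent F sat , ⊆Rhs↓ F

    satisfiable-or-refuted : ∀ F → FinitelySatisfiable F ⊎
                             Σ (List (List T)) λ V → V ⊆ᴸ F × ¬ Satisfiable V
    satisfiable-or-refuted F with em {Σ (List (List T)) λ V → V ⊆ᴸ F × ¬ Satisfiable V}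
    ... | yes refuted = inj₂ refuted
    ... | no  none    = inj₁ λ V V⊆F → decidable-stable em λ unsat → none (V , V⊆F , unsat)

    clF⇒Rhs : ∀ F A → clF F A → Rhs F A
    clF⇒Rhs F A A∈clF with satisfiable-or-refuted F
    ... | inj₁ sat               = toWitness (A∈clF (Rhs↓ F) (Rhs↓-coherent F sat) (⊆Rhs↓ F))
    ... | inj₂ (V , V⊆F , unsat) = unsatisfiable⇒Rhs F A V V⊆F unsat

    Rhs⇒clF : ∀ F A → Rhs F A → clF F A
    Rhs⇒clF F A A∈Rhs G coh F⊆G = Rhs⊆coherent F G coh F⊆G A A∈Rhs

theorem12 : ExcludedMiddle (Level.suc 0ℓ) →
    (T : Set) → T →
    (cl : Subset T → Subset T) → IsClosureOperator cl →
    (T₋ : Subset T) → (∀ t → Setup.T₊ T cl T₋ t → ¬ T₋ t) →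
    let open Setup T cl T₋ in
    (F : SDFS) →
      (FinitelyConsistent F ⇔
        (∀ (V : List (List T)) → (∀ A → A ∈ V → F A) → Σ (Subset T) (E V)))
      × (∀ A → clF F A ⇔ Rhs F A)
      × (FinitelyCoherent F ⇔ (FinitelyConsistent F × (∀ A → F A ⇔ Rhs F A)))
theorem12 em T _ cl isCl T₋ T₊∩T₋=∅ F =
    mk⇔ (consistent⇒satisfiable F) (satisfiable⇒consistent F)
  , (λ A → mk⇔ (clF⇒Rhs F A) (Rhs⇒clF F A))
  , mk⇔ (λ coh → (F , coh , F⊆F) , λ A → mk⇔ (⊆Rhs F A) (Rhs⊆coherent F F coh F⊆F A))
        (λ (cons , F⇔Rhs) →
           RhsClosure.coherent-if-⇔Rhs F (consistent⇒satisfiable F cons) F F⇔Rhs)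
  where
  open Setup T cl T₋
  open Theory T cl isCl T₋ T₊∩T₋=∅
  open Classical em
  F⊆F : F ⊆F F
  F⊆F _ A∈F = A∈F
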